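{- If $G$ is a connected graph with $\mathrm{edim}(G)=2$, then $G$ contains neither $K_5$ nor $K_{3,3}$ as a subgraph.
   Context: All graphs are finite, simple, undirected and connected; $d(u,w)$ is the length of a shortest $u$–$w$ path. For a vertex $v$ and an edge $e=xy$, $d(e,v)=\min\{d(x,v),d(y,v)\}$. For distinct edges $e_1,e_2$, $R_e\{e_1,e_2\}=\{v\in V(G): d(v,e_1)\neq d(v,e_2)\}$. A set $S\subseteq V(G)$ is an edge resolving set of $G$ if $S\cap R_e\{e_1,e_2\}\neq\emptyset$ for all distinct edges $e_1,e_2\in E(G)$; the edge dimension $\mathrm{edim}(G)$ is the minimum cardinality of an edge resolving set of $G$. -}

module Defs where

open import Data.Nat using (ℕ; zero; suc; _≤_; _⊓_)
open import Data.Fin using (Fin)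
open import Data.Fin.Subset using (Subset; _∈_; ∣_∣)
open import Data.Bool using (Bool; T)
open import Data.Product using (Σ; ∃; ∃-syntax; _×_; _,_)
open import Data.Sum using (_⊎_)
open import Relation.Binary.PropositionalEquality using (_≡_; _≢_)
open import Relation.Nullary using (¬_)

record Graph : Set where
  field
    n     : ℕ
    adj   : Fin n → Fin n → Bool
    sym   : ∀ x y → adj x y ≡ adj y x
    irrefl : ∀ x → adj x x ≡ Data.Bool.false

open Graph public

Adj : (G : Graph) → Fin (n G) → Fin (n G) → Set
Adj G x y = T (adj G x y)

data Walk (G : Graph) : Fin (n G) → Fin (n G) → ℕ → Set where
  nil  : ∀ {u} → Walk G u u 0
  cons : ∀ {u w v k} → Adj G u w → Walk G w v k → Walk G u v (suc k)

Connected : Graph → Set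
Connected G = ∀ u v → ∃[ k ] Walk G u v k

IsDist : (G : Graph) → Fin (n G) → Fin (n G) → ℕ → Set
IsDist G u v k = Walk G u v k × (∀ m → Walk G u v m → k ≤ m)

-- edges: an ordered pair of adjacent vertices (representing an unordered edge)
Edge : Graph → Set
Edge G = Σ (Fin (n G)) λ x → Σ (Fin (n G)) λ y → Adj G x y

SameEdge : (G : Graph) → Edge G → Edge G → Set
SameEdge G (x₁ , y₁ , _) (x₂ , y₂ , _) =
  (x₁ ≡ x₂ × y₁ ≡ y₂) ⊎ (x₁ ≡ y₂ × y₁ ≡ x₂)

IsEdgeDist : (G : Graph) → Edge G → Fin (n G) → ℕ → Set
IsEdgeDist G (x , y , _) v k =
  ∃[ kx ] ∃[ ky ] (IsDist G x v kx × IsDist G y v ky × k ≡ kx ⊓ ky)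

EdgeResolves : (G : Graph) → Fin (n G) → Edge G → Edge G → Set
EdgeResolves G v e₁ e₂ =
  ∃[ k₁ ] ∃[ k₂ ] (IsEdgeDist G e₁ v k₁ × IsEdgeDist G e₂ v k₂ × k₁ ≢ k₂)

EdgeResolvingSet : (G : Graph) → Subset (n G) → Set
EdgeResolvingSet G S =
  ∀ (e₁ e₂ : Edge G) → ¬ SameEdge G e₁ e₂ →
    ∃[ v ] (v ∈ S × EdgeResolves G v e₁ e₂)

EdimIs : (G : Graph) → ℕ → Set
EdimIs G d =
  (∃[ S ] (EdgeResolvingSet G S × ∣ S ∣ ≡ d)) ×
  (∀ S → EdgeResolvingSet G S → d ≤ ∣ S ∣)

ContainsK5 : Graph → Set
ContainsK5 G = Σ (Fin 5 → Fin (n G)) λ f → ((∀ (i j : Fin 5) → f i ≡ f j → i ≡ j) ×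
                       (∀ (i j : Fin 5) → i ≢ j → Adj G (f i) (f j)))

ContainsK33 : Graph → Set
ContainsK33 G =
  Σ (Fin 3 → Fin (n G)) λ f → Σ (Fin 3 → Fin (n G)) λ g →
    ((∀ (i j : Fin 3) → f i ≡ f j → i ≡ j) ×
     (∀ (i j : Fin 3) → g i ≡ g j → i ≡ j) ×
     (∀ (i j : Fin 3) → f i ≢ g j) ×
     (∀ (i j : Fin 3) → Adj G (f i) (g j)))

{-# OPTIONS --safe #-}
-- Call two edges close if every endpoint of the second is equal or adjacent to an
-- endpoint of the first; the triangle inequality then gives d(e,v) ≤ d(e′,v) + 1. Along a
-- family of pairwise close edges the distances to a fixed vertex therefore take at most
-- two consecutive values, so an edge resolving set {a, b} distinguishes at most 4 of its
-- edges. The edges of any K_{p,q} are pairwise close, and K₅ ⊇ K_{2,3} has 6 of them while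
-- K_{3,3} has 9.
module Submission where

open import Defs renaming (sym to adj-sym)
open import Data.Bool using (T)
open import Data.Bool.Properties using (T?)
open import Data.Fin as Fin using (Fin; zero; suc; toℕ; fromℕ<; _↑ˡ_; _↑ʳ_; combine; remQuot; splitAt)
import Data.Fin.Properties as Finₚ
open import Data.Fin.Properties
  using (any?; pigeonhole; toℕ-fromℕ<; combine-injective; combine-remQuot; ↑ˡ-injective; ↑ʳ-injective; splitAt-↑ˡ; splitAt-↑ʳ)
open import Data.Fin.Subset using (Subset; _∈_; ∣_∣; inside; outside)
open import Data.List using (List; []; _∷_; map; length; allFin)
open import Data.List.Extrema.Nat using (argmin; f[argmin]≤f[xs])
open import Data.List.Properties using (length-map)
import Data.List.Membership.Propositional as List
open import Data.List.Membership.Propositional.Properties using (∈-map⁺; ∈-allFin)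
open import Data.List.Relation.Unary.Any using (here; there)
import Data.List.Relation.Unary.All as All
open import Data.Nat using (ℕ; zero; suc; _+_; _*_; _∸_; _≤_; _<_; _⊓_; _<?_; s≤s)
open import Data.Nat.Properties
open import Data.Product using (Σ; ∃; ∃₂; ∃-syntax; _×_; _,_; proj₁; proj₂; uncurry)
open import Data.Product.Properties using (×-≡,≡→≡)
open import Data.Sum using (_⊎_; inj₁; inj₂; [_,_]′)
import Data.Vec as Vec
open import Relation.Nullary using (¬_; Dec; yes; no; contradiction)
open import Relation.Nullary.Decidable using (_×-dec_; from-yes)
open import Relation.Binary.PropositionalEquality
open import Function using (_∘_)

module _ (P : ℕ → Set) (P? : ∀ k → Dec (P k)) where

  Least : ℕ → Set
  Least m = P m × (∀ j → P j → m ≤ j)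

  private
    leastBelow⊎none : ∀ k → (∃ Least) ⊎ (∀ j → j < k → ¬ P j)
    leastBelow⊎none zero = inj₂ (λ _ ())
    leastBelow⊎none (suc k) with leastBelow⊎none k
    ... | inj₁ least = inj₁ least
    ... | inj₂ none with P? k
    ...   | yes pk = inj₁ (k , pk , λ j pj → ≮⇒≥ (λ j<k → none j j<k pj))
    ...   | no ¬pk = inj₂ λ j j<1+k → [ none j , (λ { refl → ¬pk }) ]′ (m<1+n⇒m<n∨m≡n j<1+k)

  least-witness : ∀ {k} → P k → ∃ Least
  least-witness {k} pk with leastBelow⊎none (suc k)
  ... | inj₁ least = least
  ... | inj₂ none = contradiction pk (none k ≤-refl)

argmin-Fin : ∀ {m} (d : Fin (suc m) → ℕ) → ∃ λ k → ∀ i → d k ≤ d i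
argmin-Fin d = k , λ i → All.lookup (f[argmin]≤f[xs] {f = d} zero (allFin _)) (∈-allFin i)
  where k = argmin d zero (allFin _)

UnitRange : ∀ {m} → (Fin m → ℕ) → Set
UnitRange d = ∃[ t ] ∀ i → t ≤ d i × d i ≤ suc t

pairwiseClose⇒unitRange : ∀ {m} (d : Fin (suc m) → ℕ) → (∀ i j → d i ≤ suc (d j)) → UnitRange d
pairwiseClose⇒unitRange d close with argmin-Fin d
... | k , min = d k , λ i → min i , close i k

module _ {t : ℕ} where

  offset : ∀ {x} → x ≤ suc t → Fin 2
  offset {x} x≤1+t = fromℕ< (s≤s (subst (x ∸ t ≤_) (m+n∸n≡m 1 t) (∸-monoˡ-≤ t x≤1+t)))

  offset-injective : ∀ {x y} → t ≤ x → t ≤ y → (p : x ≤ suc t) (q : y ≤ suc t) →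
                     offset p ≡ offset q → x ≡ y
  offset-injective {x} {y} t≤x t≤y p q eq = begin
    x             ≡⟨ m+[n∸m]≡n t≤x ⟨
    t + (x ∸ t)   ≡⟨ cong (t +_) x∸t≡y∸t ⟩
    t + (y ∸ t)   ≡⟨ m+[n∸m]≡n t≤y ⟩
    y             ∎
    where
    open ≡-Reasoning
    x∸t≡y∸t : x ∸ t ≡ y ∸ t
    x∸t≡y∸t = trans (sym (toℕ-fromℕ< _)) (trans (cong toℕ eq) (toℕ-fromℕ< _))

unitRange-pigeonhole : ∀ {m} → 4 < m → (p q : Fin m → ℕ) → UnitRange p → UnitRange q →
                       ∃₂ λ i j → i ≢ j × p i ≡ p j × q i ≡ q j
unitRange-pigeonhole 4<m p q (t , rp) (s , rq) with pigeonhole 4<m code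
  where code = λ i → combine (offset (proj₂ (rp i))) (offset (proj₂ (rq i)))
... | i , j , i<j , eq with combine-injective _ _ _ _ eq
... | eqp , eqq =
  i , j , Finₚ.<⇒≢ i<j ,
  offset-injective (proj₁ (rp i)) (proj₁ (rp j)) (proj₂ (rp i)) (proj₂ (rp j)) eqp ,
  offset-injective (proj₁ (rq i)) (proj₁ (rq j)) (proj₂ (rq i)) (proj₂ (rq j)) eqq

subset-listing : ∀ {m} (S : Subset m) →
                 ∃ λ (L : List (Fin m)) → length L ≡ ∣ S ∣ × (∀ {v} → v ∈ S → v List.∈ L)
subset-listing Vec.[] = [] , refl , λ ()
subset-listing (outside Vec.∷ S) with subset-listing S
... | L , len , complete = map suc L , trans (length-map suc L) len ,
  λ { (Vec.there v∈S) → ∈-map⁺ suc (complete v∈S) }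
subset-listing (inside Vec.∷ S) with subset-listing S
... | L , len , complete = zero ∷ map suc L , cong suc (trans (length-map suc L) len) ,
  λ { Vec.here → here refl ; (Vec.there v∈S) → there (∈-map⁺ suc (complete v∈S)) }

∣S∣≡2⇒coveredByPair : ∀ {m} (S : Subset m) → ∣ S ∣ ≡ 2 → ∃₂ λ a b → ∀ {v} → v ∈ S → v ≡ a ⊎ v ≡ b
∣S∣≡2⇒coveredByPair S ∣S∣≡2 with subset-listing S
... | a ∷ b ∷ [] , _ , complete = a , b , λ v∈S → pair (complete v∈S)
  where
  pair : ∀ {v} → v List.∈ a ∷ b ∷ [] → v ≡ a ⊎ v ≡ b
  pair (here v≡a) = inj₁ v≡a
  pair (there (here v≡b)) = inj₂ v≡b
... | [] , len , _ = contradiction (trans len ∣S∣≡2) λ ()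
... | _ ∷ [] , len , _ = contradiction (trans len ∣S∣≡2) λ ()
... | _ ∷ _ ∷ _ ∷ _ , len , _ = contradiction (trans len ∣S∣≡2) λ ()

module _ (G : Graph) where

  -- ContainsK5 G and ContainsK33 G unfold to ContainsComplete G 5 and
  -- ContainsCompleteBipartite G 3 3.
  ContainsComplete : ℕ → Set
  ContainsComplete k =
    Σ (Fin k → Fin (n G)) λ f →
      (∀ i j → f i ≡ f j → i ≡ j) × (∀ i j → i ≢ j → Adj G (f i) (f j))

  ContainsCompleteBipartite : ℕ → ℕ → Set
  ContainsCompleteBipartite p q =
    Σ (Fin p → Fin (n G)) λ f → Σ (Fin q → Fin (n G)) λ g →
      (∀ i j → f i ≡ f j → i ≡ j) × (∀ i j → g i ≡ g j → i ≡ j) ×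
      (∀ i j → f i ≢ g j) × (∀ i j → Adj G (f i) (g j))

  Adj-sym : ∀ {x y} → Adj G x y → Adj G y x
  Adj-sym {x} {y} = subst T (adj-sym G x y)

  Near : Fin (n G) → Fin (n G) → Set
  Near u w = u ≡ w ⊎ Adj G u w

  CloseEdges : Edge G → Edge G → Set
  CloseEdges (x , y , _) (x′ , y′ , _) = (Near x x′ ⊎ Near y x′) × (Near x y′ ⊎ Near y y′)

  MutuallyCloseEdges : ℕ → Set
  MutuallyCloseEdges m =
    Σ (Fin m → Edge G) λ E →
      (∀ i j → i ≢ j → ¬ SameEdge G (E i) (E j)) × (∀ i j → CloseEdges (E i) (E j))

  complete⇒completeBipartite : ∀ p q → ContainsComplete (p + q) → ContainsCompleteBipartite p q
  complete⇒completeBipartite p q (f , f-inj , f-adj) =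
    (λ i → f (i ↑ˡ q)) , (λ j → f (p ↑ʳ j)) ,
    (λ i i′ eq → ↑ˡ-injective q i i′ (f-inj _ _ eq)) ,
    (λ j j′ eq → ↑ʳ-injective p j j′ (f-inj _ _ eq)) ,
    (λ i j eq → ↑ˡ≢↑ʳ (f-inj _ _ eq)) ,
    (λ i j → f-adj _ _ ↑ˡ≢↑ʳ)
    where
    ↑ˡ≢↑ʳ : ∀ {i j} → i ↑ˡ q ≢ p ↑ʳ j
    ↑ˡ≢↑ʳ {i} {j} eq
      with () ← trans (sym (splitAt-↑ˡ p i q)) (trans (cong (splitAt p) eq) (splitAt-↑ʳ p q j))

  completeBipartite⇒mutuallyClose : ∀ p q → ContainsCompleteBipartite p q → MutuallyCloseEdges (p * q)
  completeBipartite⇒mutuallyClose p q (f , g , f-inj , g-inj , f≢g , fg-adj) = E , distinct , close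
    where
    E : Fin (p * q) → Edge G
    E k with i , j ← remQuot q k = f i , g j , fg-adj i j

    remQuot-injective : ∀ {k k′} → remQuot {p} q k ≡ remQuot q k′ → k ≡ k′
    remQuot-injective {k} {k′} eq = begin
      k                                  ≡⟨ combine-remQuot {p} q k ⟨
      uncurry combine (remQuot {p} q k)  ≡⟨ cong (uncurry combine) eq ⟩
      uncurry combine (remQuot {p} q k′) ≡⟨ combine-remQuot {p} q k′ ⟩
      k′                                 ∎
      where open ≡-Reasoning

    distinct : ∀ k k′ → k ≢ k′ → ¬ SameEdge G (E k) (E k′)
    distinct k k′ k≢k′ (inj₁ (eqf , eqg)) =
      k≢k′ (remQuot-injective (×-≡,≡→≡ (f-inj _ _ eqf , g-inj _ _ eqg)))
    distinct k k′ k≢k′ (inj₂ (eq , _)) = f≢g _ _ eq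

    close : ∀ k k′ → CloseEdges (E k) (E k′)
    close k k′ = inj₂ (inj₂ (Adj-sym (fg-adj _ _))) , inj₁ (inj₂ (fg-adj _ _))

module Distances (G : Graph) (connected : Connected G) where

  walk? : ∀ k u v → Dec (Walk G u v k)
  walk? zero u v with u Fin.≟ v
  ... | yes refl = yes nil
  ... | no u≢v = no λ { nil → u≢v refl }
  walk? (suc k) u v with any? (λ w → T? (adj G u w) ×-dec walk? k w v)
  ... | yes (w , u~w , walk) = yes (cons u~w walk)
  ... | no none = no λ { (cons u~w walk) → none (_ , u~w , walk) }

  distance : ∀ u v → ∃ (IsDist G u v)
  distance u v with k , walk ← connected u v =
    least-witness (λ k → Walk G u v k) (λ k → walk? k u v) walk

  dist : Fin (n G) → Fin (n G) → ℕ
  dist u v = proj₁ (distance u v)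

  dist-isDist : ∀ u v → IsDist G u v (dist u v)
  dist-isDist u v = proj₂ (distance u v)

  isDist-unique : ∀ {u v k k′} → IsDist G u v k → IsDist G u v k′ → k ≡ k′
  isDist-unique (walk , shortest) (walk′ , shortest′) = ≤-antisym (shortest _ walk′) (shortest′ _ walk)

  dist-near : ∀ {u w} → Near G u w → ∀ v → dist u v ≤ suc (dist w v)
  dist-near (inj₁ refl) v = n≤1+n _
  dist-near {u} {w} (inj₂ u~w) v = proj₂ (dist-isDist u v) _ (cons u~w (proj₁ (dist-isDist w v)))

  eDist : Edge G → Fin (n G) → ℕ
  eDist (x , y , _) v = dist x v ⊓ dist y v

  isEdgeDist⇒≡eDist : ∀ e v {k} → IsEdgeDist G e v k → k ≡ eDist e v
  isEdgeDist⇒≡eDist (x , y , _) v (_ , _ , dx , dy , refl) =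
    cong₂ _⊓_ (isDist-unique dx (dist-isDist x v)) (isDist-unique dy (dist-isDist y v))

  eDist-close : ∀ {e e′} → CloseEdges G e e′ → ∀ v → eDist e v ≤ suc (eDist e′ v)
  eDist-close {x , y , _} (near-x′ , near-y′) v = ⊓-glb (toEndpoint near-x′) (toEndpoint near-y′)
    where
    toEndpoint : ∀ {w} → Near G x w ⊎ Near G y w → dist x v ⊓ dist y v ≤ suc (dist w v)
    toEndpoint (inj₁ x≈w) = ≤-trans (m⊓n≤m _ _) (dist-near x≈w v)
    toEndpoint (inj₂ y≈w) = ≤-trans (m⊓n≤n _ _) (dist-near y≈w v)

  edgeResolves⇒eDist≢ : ∀ {v e₁ e₂} → EdgeResolves G v e₁ e₂ → eDist e₁ v ≢ eDist e₂ v
  edgeResolves⇒eDist≢ {v} {e₁} {e₂} (_ , _ , d₁ , d₂ , d₁≢d₂) eq =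
    d₁≢d₂ (trans (isEdgeDist⇒≡eDist e₁ v d₁) (trans eq (sym (isEdgeDist⇒≡eDist e₂ v d₂))))

  resolvingPair-separates : ∀ {S a b} → EdgeResolvingSet G S → (∀ {v} → v ∈ S → v ≡ a ⊎ v ≡ b) →
                            ∀ e₁ e₂ → ¬ SameEdge G e₁ e₂ →
                            eDist e₁ a ≡ eDist e₂ a → eDist e₁ b ≢ eDist e₂ b
  resolvingPair-separates resolving cover e₁ e₂ e₁≢e₂ eq-a eq-b
    with v , v∈S , v-resolves ← resolving e₁ e₂ e₁≢e₂
    with cover v∈S
  ... | inj₁ refl = edgeResolves⇒eDist≢ {e₁ = e₁} {e₂} v-resolves eq-a
  ... | inj₂ refl = edgeResolves⇒eDist≢ {e₁ = e₁} {e₂} v-resolves eq-b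

  mutuallyClose⇒unitRange : ∀ {m} (E : Fin (suc m) → Edge G) → (∀ i j → CloseEdges G (E i) (E j)) →
                            ∀ v → UnitRange (λ i → eDist (E i) v)
  mutuallyClose⇒unitRange E close v =
    pairwiseClose⇒unitRange (λ i → eDist (E i) v) λ i j → eDist-close {E i} {E j} (close i j) v

  edim2⇒¬mutuallyClose : EdimIs G 2 → ∀ {m} → 4 < m → ¬ MutuallyCloseEdges G m
  edim2⇒¬mutuallyClose ((S , resolving , ∣S∣≡2) , _) {suc m} 4<m (E , distinct , close) =
    let a , b , cover = ∣S∣≡2⇒coveredByPair S ∣S∣≡2
        i , j , i≢j , eq-a , eq-b =
          unitRange-pigeonhole 4<m (λ i → eDist (E i) a) (λ i → eDist (E i) b)
            (mutuallyClose⇒unitRange E close a) (mutuallyClose⇒unitRange E close b)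
    in resolvingPair-separates resolving cover (E i) (E j) (distinct i j i≢j) eq-a eq-b

  edim2⇒¬completeBipartite : EdimIs G 2 → ∀ p q → 4 < p * q → ¬ ContainsCompleteBipartite G p q
  edim2⇒¬completeBipartite edim2 p q 4<pq =
    edim2⇒¬mutuallyClose edim2 4<pq ∘ completeBipartite⇒mutuallyClose G p q

mainTheorem2 : (G : Graph) → Connected G → EdimIs G 2 →
    ¬ ContainsK5 G × ¬ ContainsK33 G
mainTheorem2 G connected edim2 =
  ¬K[2,3] ∘ complete⇒completeBipartite G 2 3 ,
  edim2⇒¬completeBipartite edim2 3 3 (from-yes (4 <? 3 * 3))
  where
  open Distances G connected
  ¬K[2,3] : ¬ ContainsCompleteBipartite G 2 3
  ¬K[2,3] = edim2⇒¬completeBipartite edim2 2 3 (from-yes (4 <? 2 * 3))
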